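{- Let $n \ge 2$ be an integer and let $p(k)$ denote the number of partitions of the nonnegative integer $k$, with $p(0)=1$. Call an ordered pair $(\lambda,\mu)$ of partitions of $n$ a right-hand one-unit neighbor pair if $\mu$ has exactly one more nonzero part than $\lambda$, and $\mu$ is obtained from $\lambda$ (written as a vector of parts padded with zeros) by decreasing one entry by $1$ and increasing another entry by $1$, and then rearranging the entries in nonincreasing order. Then the number of right-hand one-unit neighbor pairs of partitions of $n$ equals $$P(n)=\sum_{k=0}^{n-2} p(k).$$
   Context: A partition of $n$ is a nonincreasing sequence of positive integers (its nonzero parts) summing to $n$; it may be written as a vector of any length $\ge$ its number of nonzero parts by appending zero entries. Two partitions of $n$ are nearest neighbors (one-unit neighbors) if one is obtained from the other by moving a single unit from one entry of the padded vector to another entry. A pair is "right-hand" when the second partition has exactly one more nonzero part than the first. -}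

module Defs where

open import Data.Nat using (ℕ; zero; suc; _+_; _∸_; _≤_; _<_; _≥_; pred)
open import Data.Nat.ListAction using (sum)
open import Data.List using (List; []; _∷_; length; map; upTo; replicate; _++_)
open import Data.List.Relation.Unary.All using (All)
open import Data.List.Relation.Unary.Linked using (Linked)
open import Data.List.Relation.Unary.Unique.Propositional using (Unique)
open import Data.List.Membership.Propositional using (_∈_)
open import Data.List.Relation.Binary.Permutation.Propositional using (_↭_)
open import Data.Product using (_×_; _,_; ∃-syntax)
open import Relation.Binary.PropositionalEquality using (_≡_; _≢_)
open import Function.Bundles using (_⇔_)

IsPartitionOf : ℕ → List ℕ → Set
IsPartitionOf k l = All (λ x → 1 ≤ x) l × Linked _≥_ l × sum l ≡ k

at : ℕ → List ℕ → ℕ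
at _       []       = 0
at zero    (x ∷ xs) = x
at (suc i) (x ∷ xs) = at i xs

modifyAt : ℕ → (ℕ → ℕ) → List ℕ → List ℕ
modifyAt _       f []       = []
modifyAt zero    f (x ∷ xs) = f x ∷ xs
modifyAt (suc i) f (x ∷ xs) = x ∷ modifyAt i f xs

pad : ℕ → List ℕ → List ℕ
pad m l = l ++ replicate (m ∸ length l) 0

-- μ is obtained from λ (padded with zeros to some length m) by decreasing
-- entry i by 1 and increasing a different entry j by 1, then rearranging
-- in nonincreasing order (i.e. μ padded to length m is a rearrangement of
-- the modified vector).
OneUnitMove : List ℕ → List ℕ → Set
OneUnitMove lam mu =
  ∃[ m ] ∃[ i ] ∃[ j ]
    (length lam ≤ m × length mu ≤ m × i < m × j < m × i ≢ j ×
     1 ≤ at i (pad m lam) ×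
     pad m mu ↭ modifyAt j suc (modifyAt i pred (pad m lam)))

RightHandPair : ℕ → List ℕ × List ℕ → Set
RightHandPair n (lam , mu) =
  IsPartitionOf n lam × IsPartitionOf n mu ×
  length mu ≡ suc (length lam) × OneUnitMove lam mu

-- "the number of x with P x is c": a duplicate-free list enumerating exactly
-- the x with P x, of length c.
HasCount : {A : Set} → (A → Set) → ℕ → Set
HasCount {A} P c = ∃[ L ] (Unique L × (∀ (x : A) → (x ∈ L ⇔ P x)) × length L ≡ c)

bigP : (ℕ → ℕ) → ℕ → ℕ
bigP p n = sum (map p (upTo (n ∸ 1)))

{-# OPTIONS --safe #-}
-- A one-unit move takes an entry a ≥ 1 to a − 1 and an entry b to b + 1, so it
-- adds a nonzero part exactly when a ≥ 2 and b = 0.  Hence the right-hand pairs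
-- are the pairs (ν ∪ {a}, ν ∪ {a − 1, 1}) with 2 ≤ a ≤ n and ν a partition of
-- n − a.  The pair determines a, because Σ T(part) with T the triangular
-- numbers drops by exactly a − 1 from the first partition to the second, and
-- then it determines ν.  Counting these pairs by k = n − a gives Σ_{k ≤ n−2} p(k).
module Submission where

open import Defs
open import Data.Empty using (⊥-elim)
open import Relation.Nullary using (¬_)
open import Data.Nat using (ℕ; zero; suc; _+_; _∸_; _≤_; _<_; _≥_; pred; z≤n; s≤s)
open import Data.Nat.Properties
open import Data.Nat.ListAction using (sum)
open import Data.Nat.ListAction.Properties using (sum-↭)
open import Data.List using (List; []; _∷_; _++_; length; map; upTo; replicate; filter)
open import Data.List.Properties
  using (length-++; length-map; length-replicate; ++-identityʳ; filter-++; filter-all; filter-none)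
open import Data.List.Relation.Unary.All as All using (All; _∷_)
import Data.List.Relation.Unary.All.Properties as All
open import Data.List.Relation.Unary.Any using (here; there)
open import Data.List.Relation.Unary.Linked using (Linked)
open import Data.List.Relation.Unary.Unique.Propositional using (Unique; []; _∷_)
import Data.List.Relation.Unary.Unique.Propositional.Properties as Unique
open import Data.List.Relation.Binary.Equality.Propositional using (≋⇒≡)
open import Data.List.Relation.Binary.Permutation.Propositional
  using (_↭_; ↭-refl; ↭-sym; ↭-trans; ↭-prep; ↭-swap; ↭-reflexive; ↭⇒↭ₛ)
open import Data.List.Relation.Binary.Permutation.Propositional.Properties
  using (↭-length; ++⁺ˡ; ++⁺ʳ; shift; drop-mid; drop-∷; ∷↭∷ʳ; ∈-resp-↭; All-resp-↭; filter-↭)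
  renaming (map⁺ to ↭-map⁺)
open import Data.List.Membership.Propositional using (_∈_)
open import Data.List.Membership.Propositional.Properties
  using (∈-map⁺; ∈-map⁻; ∈-++⁺ˡ; ∈-++⁺ʳ; ∈-++⁻; ∈-upTo⁺; ∈-upTo⁻)
open import Data.List.Relation.Unary.Sorted.TotalOrder.Properties using (↗↭↗⇒≋)
open import Data.Product using (_×_; _,_; ∃-syntax; proj₁; proj₂)
open import Data.Sum using (inj₁; inj₂)
open import Function.Base using (_∘_)
open import Function.Bundles using (_⇔_; mk⇔; Equivalence)
open import Relation.Binary.Bundles using (DecTotalOrder)
import Relation.Binary.Construct.Flip.EqAndOrd as Flip
open import Relation.Binary.PropositionalEquality
  using (_≡_; _≢_; refl; sym; trans; cong; cong₂; subst; module ≡-Reasoning)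

≥-decTotalOrder : DecTotalOrder _ _ _
≥-decTotalOrder = Flip.decTotalOrder ≤-decTotalOrder

open import Data.List.Sort.InsertionSort.Base ≥-decTotalOrder using (sort)
open import Data.List.Sort.InsertionSort.Properties ≥-decTotalOrder using (sort-↭; sort-↗)

∈⇒at : ∀ {x xs} → x ∈ xs → ∃[ i ] (i < length xs × at i xs ≡ x)
∈⇒at (here refl) = 0 , s≤s z≤n , refl
∈⇒at (there x∈xs) with i , i<|xs| , xᵢ≡x ← ∈⇒at x∈xs = suc i , s≤s i<|xs| , xᵢ≡x

modifyAt-↭ : ∀ (g : ℕ → ℕ) v {i} → i < length v →
  ∃[ r ] (v ↭ at i v ∷ r × modifyAt i g v ↭ g (at i v) ∷ r)
modifyAt-↭ g (x ∷ xs) {zero}  _            = xs , ↭-refl , ↭-refl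
modifyAt-↭ g (x ∷ xs) {suc i} (s≤s i<|xs|) with r , p , q ← modifyAt-↭ g xs i<|xs| =
  x ∷ r , ↭-trans (↭-prep x p) (↭-sym (shift x (_ ∷ []) r)) ,
          ↭-trans (↭-prep x q) (↭-sym (shift x (_ ∷ []) r))

modifyAt₂-↭ : ∀ (g h : ℕ → ℕ) v {i j} → i ≢ j → i < length v → j < length v →
  ∃[ r ] (v ↭ at i v ∷ at j v ∷ r ×
          modifyAt j h (modifyAt i g v) ↭ g (at i v) ∷ h (at j v) ∷ r)
modifyAt₂-↭ g h (x ∷ xs) {zero}  {zero}  i≢j _ _ = ⊥-elim (i≢j refl)
modifyAt₂-↭ g h (x ∷ xs) {zero}  {suc j} _ _ (s≤s j<n)
  with r , p , q ← modifyAt-↭ h xs j<n = r , ↭-prep x p , ↭-prep (g x) q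
modifyAt₂-↭ g h (x ∷ xs) {suc i} {zero}  _ (s≤s i<n) _
  with r , p , q ← modifyAt-↭ g xs i<n =
  r , ↭-trans (↭-prep x p) (↭-swap x _ ↭-refl) , ↭-trans (↭-prep (h x) q) (↭-swap (h x) _ ↭-refl)
modifyAt₂-↭ g h (x ∷ xs) {suc i} {suc j} i≢j (s≤s i<n) (s≤s j<n)
  with r , p , q ← modifyAt₂-↭ g h xs (λ i≡j → i≢j (cong suc i≡j)) i<n j<n =
  x ∷ r , ↭-trans (↭-prep x p) (↭-sym (shift x (_ ∷ _ ∷ []) r)) ,
          ↭-trans (↭-prep x q) (↭-sym (shift x (_ ∷ _ ∷ []) r))

positive-zero⇒≢ : ∀ v {i j} → 1 ≤ at i v → at j v ≡ 0 → i ≢ j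
positive-zero⇒≢ v 1≤vᵢ vⱼ≡0 refl = 1+n≰n (subst (1 ≤_) vⱼ≡0 1≤vᵢ)

unitToZero-↭ : ∀ v {i j} → i < length v → j < length v → 1 ≤ at i v → at j v ≡ 0 →
  ∃[ r ] (v ↭ at i v ∷ 0 ∷ r × modifyAt j suc (modifyAt i pred v) ↭ pred (at i v) ∷ 1 ∷ r)
unitToZero-↭ v {i} {j} i<|v| j<|v| 1≤vᵢ vⱼ≡0 =
  subst (λ y → ∃[ r ] (v ↭ at i v ∷ y ∷ r ×
                       modifyAt j suc (modifyAt i pred v) ↭ pred (at i v) ∷ suc y ∷ r))
        vⱼ≡0 (modifyAt₂-↭ pred suc v (positive-zero⇒≢ v 1≤vᵢ vⱼ≡0) i<|v| j<|v|)

length-pad : ∀ m xs → length xs ≤ m → length (pad m xs) ≡ m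
length-pad m xs |xs|≤m = begin
  length (xs ++ zeros)           ≡⟨ length-++ xs ⟩
  length xs + length zeros       ≡⟨ cong (length xs +_) (length-replicate (m ∸ length xs)) ⟩
  length xs + (m ∸ length xs)    ≡⟨ m+[n∸m]≡n |xs|≤m ⟩
  m                              ∎
  where
  open ≡-Reasoning
  zeros = replicate (m ∸ length xs) 0

pad-length : ∀ {m} xs → length xs ≡ m → pad m xs ≡ xs
pad-length xs refl = trans (cong (λ k → xs ++ replicate k 0) (n∸n≡0 (length xs))) (++-identityʳ xs)

pad-suc-length : ∀ xs → pad (suc (length xs)) xs ≡ xs ++ 0 ∷ []
pad-suc-length xs = cong (λ k → xs ++ replicate k 0) (m+n∸n≡m 1 (length xs))

at-pad-length : ∀ xs → at (length xs) (pad (suc (length xs)) xs) ≡ 0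
at-pad-length xs = trans (cong (at (length xs)) (pad-suc-length xs)) (at-++-length xs)
  where
  at-++-length : ∀ xs {y ys} → at (length xs) (xs ++ y ∷ ys) ≡ y
  at-++-length []       = refl
  at-++-length (x ∷ xs) = at-++-length xs

parts : List ℕ → List ℕ
parts = filter (1 ≤?_)

parts-pad : ∀ m {xs} → All (1 ≤_) xs → parts (pad m xs) ≡ xs
parts-pad m {xs} xs⁺ = begin
  parts (xs ++ zeros)     ≡⟨ filter-++ (1 ≤?_) xs zeros ⟩
  parts xs ++ parts zeros ≡⟨ cong₂ _++_ (filter-all (1 ≤?_) xs⁺) (filter-none (1 ≤?_) zeros≱1) ⟩
  xs ++ []                ≡⟨ ++-identityʳ xs ⟩
  xs                      ∎
  where
  open ≡-Reasoning
  zeros = replicate (m ∸ length xs) 0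
  zeros≱1 : All (λ x → ¬ 1 ≤ x) zeros
  zeros≱1 = All.replicate⁺ (m ∸ length xs) λ ()

oneUnitMove⇒↭parts : ∀ {lam mu} → All (1 ≤_) lam → All (1 ≤_) mu → OneUnitMove lam mu →
  ∃[ x ] ∃[ y ] ∃[ r ] (1 ≤ x × lam ↭ parts (x ∷ y ∷ r) × mu ↭ parts (pred x ∷ suc y ∷ r))
oneUnitMove⇒↭parts {lam} lam⁺ mu⁺ (m , i , j , |lam|≤m , _ , i<m , j<m , i≢j , 1≤xᵢ , mu↭) =
  let r , p , q = modifyAt₂-↭ pred suc v i≢j (fits i<m) (fits j<m)
  in  at i v , at j v , r , 1≤xᵢ ,
      subst (_↭ parts (at i v ∷ at j v ∷ r)) (parts-pad m lam⁺) (filter-↭ (1 ≤?_) p) ,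
      subst (_↭ parts (pred (at i v) ∷ suc (at j v) ∷ r)) (parts-pad m mu⁺)
            (filter-↭ (1 ≤?_) (↭-trans mu↭ q))
  where
  v = pad m lam
  fits : ∀ {k} → k < m → k < length v
  fits {k} = subst (k <_) (sym (length-pad m lam |lam|≤m))

partsIncrease⇒split : ∀ x y r → 1 ≤ x →
  length (parts (pred x ∷ suc y ∷ r)) ≡ suc (length (parts (x ∷ y ∷ r))) →
  ∃[ b ] (x ≡ suc (suc b) × y ≡ 0)
partsIncrease⇒split (suc zero)    zero    r _ e = ⊥-elim (1+n≢n (sym e))
partsIncrease⇒split (suc zero)    (suc y) r _ e = ⊥-elim (m≢1+n+m _ {1} e)
partsIncrease⇒split (suc (suc b)) zero    r _ _ = b , refl , refl
partsIncrease⇒split (suc (suc b)) (suc y) r _ e = ⊥-elim (1+n≢n (sym e))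

rightHandMove⇒split : ∀ {lam mu} → All (1 ≤_) lam → All (1 ≤_) mu → OneUnitMove lam mu →
  length mu ≡ suc (length lam) →
  ∃[ a ] ∃[ rest ] (2 ≤ a × lam ↭ a ∷ rest × mu ↭ pred a ∷ 1 ∷ rest)
rightHandMove⇒split lam⁺ mu⁺ move |mu|≡1+|lam|
  with x , y , r , 1≤x , p , q ← oneUnitMove⇒↭parts lam⁺ mu⁺ move
  with b , refl , refl ← partsIncrease⇒split x y r 1≤x
         (trans (sym (↭-length q)) (trans |mu|≡1+|lam| (cong suc (↭-length p))))
  = suc (suc b) , parts r , s≤s (s≤s z≤n) , p , q

-- Pad λ with one zero and move a unit from an entry a to that zero.
split⇒oneUnitMove : ∀ {a rest lam mu} → 1 ≤ a → lam ↭ a ∷ rest → mu ↭ pred a ∷ 1 ∷ rest →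
  OneUnitMove lam mu
split⇒oneUnitMove {rest = rest} {lam} {mu} 1≤a lam↭ mu↭
  with i , i<|v| , refl ← ∈⇒at {xs = pad (suc (length lam)) lam}
                            (∈-++⁺ˡ (∈-resp-↭ (↭-sym lam↭) (here refl)))
  = let r , v↭r , moved↭ = unitToZero-↭ v i<|v| j<|v| 1≤a (at-pad-length lam) in
    m , i , length lam , n≤1+n _ , ≤-reflexive |mu|≡m , subst (i <_) |v|≡m i<|v| , ≤-refl ,
    positive-zero⇒≢ v 1≤a (at-pad-length lam) , 1≤a ,
    ↭-trans (↭-reflexive (pad-length mu |mu|≡m))
            (↭-trans mu↭ (↭-trans (↭-prep _ (↭-prep 1 (rest↭ v↭r))) (↭-sym moved↭)))
  where
  m = suc (length lam)
  v = pad m lam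
  |v|≡m : length v ≡ m
  |v|≡m = length-pad m lam (n≤1+n _)
  j<|v| : length lam < length v
  j<|v| = subst (length lam <_) (sym |v|≡m) ≤-refl
  |mu|≡m : length mu ≡ m
  |mu|≡m = trans (↭-length mu↭) (cong suc (sym (↭-length lam↭)))
  v↭rest : v ↭ at i v ∷ 0 ∷ rest
  v↭rest = subst (_↭ at i v ∷ 0 ∷ rest) (sym (pad-suc-length lam))
                 (↭-trans (++⁺ʳ (0 ∷ []) lam↭) (↭-prep (at i v) (↭-sym (∷↭∷ʳ 0 rest))))
  rest↭ : ∀ {r} → v ↭ at i v ∷ 0 ∷ r → rest ↭ r
  rest↭ v↭r = drop-∷ (drop-∷ (↭-trans (↭-sym v↭rest) v↭r))

↗↭↗⇒≡ : ∀ {xs ys} → Linked _≥_ xs → Linked _≥_ ys → xs ↭ ys → xs ≡ ys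
↗↭↗⇒≡ xs↗ ys↗ xs↭ys =
  ≋⇒≡ (↗↭↗⇒≋ (DecTotalOrder.totalOrder ≥-decTotalOrder) xs↗ ys↗ (↭⇒↭ₛ xs↭ys))

sort-≡⇒↭ : ∀ {xs ys} → sort xs ≡ sort ys → xs ↭ ys
sort-≡⇒↭ {xs} {ys} eq = ↭-trans (↭-sym (sort-↭ xs)) (↭-trans (↭-reflexive eq) (sort-↭ ys))

triangle : ℕ → ℕ
triangle zero    = 0
triangle (suc b) = suc b + triangle b

Σtriangle : List ℕ → ℕ
Σtriangle xs = sum (map triangle xs)

Σtriangle-↭ : ∀ {xs ys} → xs ↭ ys → Σtriangle xs ≡ Σtriangle ys
Σtriangle-↭ xs↭ys = sum-↭ (↭-map⁺ triangle xs↭ys)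

Σtriangle-pred : ∀ a xs → Σtriangle (a ∷ xs) ≡ a + Σtriangle (pred a ∷ xs)
Σtriangle-pred zero    xs = refl
Σtriangle-pred (suc b) xs = +-assoc (suc b) (triangle b) (Σtriangle xs)

↭-pred-injective : ∀ {a a' xs ys} → a ∷ xs ↭ a' ∷ ys → pred a ∷ xs ↭ pred a' ∷ ys → a ≡ a'
↭-pred-injective {a} {a'} {xs} {ys} p q = +-cancelʳ-≡ (Σtriangle (pred a ∷ xs)) a a' (begin
  a + Σtriangle (pred a ∷ xs)   ≡⟨ Σtriangle-pred a xs ⟨
  Σtriangle (a ∷ xs)            ≡⟨ Σtriangle-↭ p ⟩
  Σtriangle (a' ∷ ys)           ≡⟨ Σtriangle-pred a' ys ⟩
  a' + Σtriangle (pred a' ∷ ys) ≡⟨ cong (a' +_) (Σtriangle-↭ q) ⟨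
  a' + Σtriangle (pred a ∷ xs)  ∎)
  where open ≡-Reasoning

splitOff : ℕ → List ℕ → List ℕ × List ℕ
splitOff a ν = sort (a ∷ ν) , sort (pred a ∷ 1 ∷ ν)

splitOff-injective : ∀ {a a' ν ν'} → Linked _≥_ ν → Linked _≥_ ν' →
  splitOff a ν ≡ splitOff a' ν' → a ≡ a' × ν ≡ ν'
splitOff-injective {a} {a'} ν↗ ν'↗ eq
  with lam↭ ← sort-≡⇒↭ (cong proj₁ eq)
  with refl ← ↭-pred-injective {a} {a'} lam↭
                (drop-mid (pred a ∷ []) (pred a' ∷ []) (sort-≡⇒↭ (cong proj₂ eq)))
  = refl , ↗↭↗⇒≡ ν↗ ν'↗ (drop-∷ lam↭)

splitOff-rightHand : ∀ {a k ν} → 2 ≤ a → IsPartitionOf k ν → RightHandPair (a + k) (splitOff a ν)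
splitOff-rightHand {suc (suc b)} {k} {ν} (s≤s (s≤s z≤n)) (ν⁺ , _ , Σν≡k) =
  (All-resp-↭ (↭-sym lam↭) (s≤s z≤n ∷ ν⁺) , sort-↗ (suc (suc b) ∷ ν) ,
   trans (sum-↭ lam↭) (cong (suc (suc b) +_) Σν≡k)) ,
  (All-resp-↭ (↭-sym mu↭) (s≤s z≤n ∷ s≤s z≤n ∷ ν⁺) , sort-↗ (suc b ∷ 1 ∷ ν) ,
   trans (sum-↭ mu↭) (trans (+-suc (suc b) (sum ν)) (cong (suc (suc b) +_) Σν≡k))) ,
  trans (↭-length mu↭) (cong suc (sym (↭-length lam↭))) ,
  split⇒oneUnitMove (s≤s z≤n) lam↭ mu↭
  where
  lam↭ : sort (suc (suc b) ∷ ν) ↭ suc (suc b) ∷ ν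
  lam↭ = sort-↭ _
  mu↭ : sort (suc b ∷ 1 ∷ ν) ↭ suc b ∷ 1 ∷ ν
  mu↭ = sort-↭ _

rightHand⇒splitOff : ∀ {n lam mu} → RightHandPair n (lam , mu) →
  ∃[ a ] ∃[ k ] ∃[ ν ] (2 ≤ a × a + k ≡ n × IsPartitionOf k ν × splitOff a ν ≡ (lam , mu))
rightHand⇒splitOff ((lam⁺ , lam↗ , Σlam≡n) , (mu⁺ , mu↗ , _) , |mu|≡1+|lam| , move)
  with a , rest , 2≤a , lam↭ , mu↭ ← rightHandMove⇒split lam⁺ mu⁺ move |mu|≡1+|lam|
  = a , sum rest , sort rest , 2≤a , trans (sym (sum-↭ lam↭)) Σlam≡n ,
    (All-resp-↭ (↭-sym (sort-↭ rest)) (All.tail (All-resp-↭ lam↭ lam⁺)) ,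
     sort-↗ rest , sum-↭ (sort-↭ rest)) ,
    cong₂ _,_ (sorted-as (a ∷ []) lam↗ lam↭) (sorted-as (pred a ∷ 1 ∷ []) mu↗ mu↭)
  where
  sorted-as : ∀ {xs} ys → Linked _≥_ xs → xs ↭ ys ++ rest → sort (ys ++ sort rest) ≡ xs
  sorted-as ys xs↗ xs↭ = ↗↭↗⇒≡ (sort-↗ (ys ++ sort rest)) xs↗
    (↭-trans (sort-↭ _) (↭-trans (++⁺ˡ ys (sort-↭ rest)) (↭-sym xs↭)))

Unique-map⁺ : ∀ {A B : Set} {f : A → B} {xs} →
  (∀ {x y} → x ∈ xs → y ∈ xs → f x ≡ f y → x ≡ y) → Unique xs → Unique (map f xs)
Unique-map⁺ inj []          = []
Unique-map⁺ inj (x∉ ∷ uniq) =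
  All.map⁺ (All.tabulate λ y∈ fx≡fy → All.lookup x∉ y∈ (inj (here refl) (there y∈) fx≡fy)) ∷
  Unique-map⁺ (λ x∈ y∈ → inj (there x∈) (there y∈)) uniq

HasCount-map : ∀ {A B : Set} {P : A → Set} {Q : B → Set} {c} (f : A → B) →
  (∀ {x y} → P x → P y → f x ≡ f y → x ≡ y) →
  (∀ y → Q y ⇔ (∃[ x ] (P x × f x ≡ y))) →
  HasCount P c → HasCount Q c
HasCount-map {Q = Q} f inj Q⇔ (L , uniq , L⇔P , |L|≡c) =
  map f L , Unique-map⁺ (λ x∈ y∈ → inj (to (L⇔P _) x∈) (to (L⇔P _) y∈)) uniq ,
  (λ y → mk⇔ ∈⇒Q Q⇒∈) , trans (length-map f L) |L|≡c
  where
  open Equivalence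
  ∈⇒Q : ∀ {y} → y ∈ map f L → Q y
  ∈⇒Q y∈ with x , x∈ , refl ← ∈-map⁻ f y∈ = from (Q⇔ _) (x , to (L⇔P x) x∈ , refl)
  Q⇒∈ : ∀ {y} → Q y → y ∈ map f L
  Q⇒∈ Qy with x , Px , refl ← to (Q⇔ _) Qy = ∈-map⁺ f (from (L⇔P x) Px)

Tagged : {A : Set} → List ℕ → (ℕ → A → Set) → ℕ × A → Set
Tagged ks P (k , x) = k ∈ ks × P k x

HasCount-Tagged : ∀ {A : Set} {P : ℕ → A → Set} {c : ℕ → ℕ} → (∀ k → HasCount (P k) (c k)) →
  ∀ {ks} → Unique ks → HasCount (Tagged ks P) (sum (map c ks))
HasCount-Tagged count [] = [] , [] , (λ _ → mk⇔ (λ ()) (λ ())) , refl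
HasCount-Tagged {P = P} count {k ∷ ks} (k∉ks ∷ uniq)
  with L , uniqL , L⇔ , |L|≡ ← count k
  with M , uniqM , M⇔ , |M|≡ ← HasCount-Tagged count uniq
  = map (k ,_) L ++ M ,
    Unique.++⁺ (Unique.map⁺ (cong proj₂) uniqL) uniqM disjoint ,
    (λ _ → mk⇔ ∈⇒Tagged Tagged⇒∈) ,
    trans (length-++ (map (k ,_) L)) (cong₂ _+_ (trans (length-map (k ,_) L) |L|≡) |M|≡)
  where
  open Equivalence
  disjoint : ∀ {v} → ¬ (v ∈ map (k ,_) L × v ∈ M)
  disjoint (v∈L , v∈M) with _ , _ , refl ← ∈-map⁻ (k ,_) v∈L =
    All.lookup k∉ks (proj₁ (to (M⇔ _) v∈M)) refl
  ∈⇒Tagged : ∀ {v} → v ∈ map (k ,_) L ++ M → Tagged (k ∷ ks) P v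
  ∈⇒Tagged v∈ with ∈-++⁻ (map (k ,_) L) v∈
  ... | inj₁ v∈L with x , x∈ , refl ← ∈-map⁻ (k ,_) v∈L = here refl , to (L⇔ x) x∈
  ... | inj₂ v∈M with k'∈ , Pv ← to (M⇔ _) v∈M = there k'∈ , Pv
  Tagged⇒∈ : ∀ {v} → Tagged (k ∷ ks) P v → v ∈ map (k ,_) L ++ M
  Tagged⇒∈ {k , x} (here refl , Px) = ∈-++⁺ˡ (∈-map⁺ (k ,_) (from (L⇔ x) Px))
  Tagged⇒∈ (there k'∈ , Pv) = ∈-++⁺ʳ _ (from (M⇔ _) (k'∈ , Pv))

<∸1⇒≤ : ∀ {k n} → k < n ∸ 1 → k ≤ n
<∸1⇒≤ {n = n} k<n∸1 = ≤-trans (<⇒≤ k<n∸1) (m∸n≤m n 1)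

<∸1⇒2≤∸ : ∀ {k n} → k < n ∸ 1 → 2 ≤ n ∸ k
<∸1⇒2≤∸ {n = suc n} k<n = m+n≤o⇒m≤o∸n 2 (s≤s k<n)

2≤⇒<+∸1 : ∀ {a k} → 2 ≤ a → k < a + k ∸ 1
2≤⇒<+∸1 {suc (suc b)} {k} (s≤s (s≤s z≤n)) = s≤s (m≤n+m k b)

splitOffFrom : ℕ → ℕ × List ℕ → List ℕ × List ℕ
splitOffFrom n (k , ν) = splitOff (n ∸ k) ν

splitOffFrom-rightHand : ∀ {n} x → Tagged (upTo (n ∸ 1)) IsPartitionOf x →
  RightHandPair n (splitOffFrom n x)
splitOffFrom-rightHand {n} (k , ν) (k∈ , ν-part) =
  subst (λ m → RightHandPair m (splitOffFrom n (k , ν))) (m∸n+n≡m (<∸1⇒≤ (∈-upTo⁻ k∈)))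
        (splitOff-rightHand (<∸1⇒2≤∸ (∈-upTo⁻ k∈)) ν-part)

splitOff⇒splitOffFrom : ∀ {n v} →
  (∃[ a ] ∃[ k ] ∃[ ν ] (2 ≤ a × a + k ≡ n × IsPartitionOf k ν × splitOff a ν ≡ v)) →
  ∃[ x ] (Tagged (upTo (n ∸ 1)) IsPartitionOf x × splitOffFrom n x ≡ v)
splitOff⇒splitOffFrom (a , k , ν , 2≤a , refl , ν-part , eq) =
  (k , ν) , (∈-upTo⁺ (2≤⇒<+∸1 2≤a) , ν-part) , trans (cong (λ a → splitOff a ν) (m+n∸n≡m a k)) eq

splitOffFrom-injective : ∀ n {x y} →
  Tagged (upTo (n ∸ 1)) IsPartitionOf x → Tagged (upTo (n ∸ 1)) IsPartitionOf y →
  splitOffFrom n x ≡ splitOffFrom n y → x ≡ y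
splitOffFrom-injective n {k , ν} {k' , _} (k∈ , _ , ν↗ , _) (k'∈ , _ , ν'↗ , _) eq
  with n∸k≡n∸k' , refl ← splitOff-injective ν↗ ν'↗ eq
  = cong (_, ν) (∸-cancelˡ-≡ (<∸1⇒≤ (∈-upTo⁻ k∈)) (<∸1⇒≤ (∈-upTo⁻ k'∈)) n∸k≡n∸k')

-- For n < 2 both sides count nothing.
mainTheorem1 : (n : ℕ) → 2 ≤ n → (p : ℕ → ℕ) →
    (∀ k → HasCount (IsPartitionOf k) (p k)) →
    HasCount (RightHandPair n) (bigP p n)
mainTheorem1 n _ p count =
  HasCount-map (splitOffFrom n) (splitOffFrom-injective n)
    (λ { (_ , _) → mk⇔ (splitOff⇒splitOffFrom ∘ rightHand⇒splitOff)
                      λ { (x , x∈ , refl) → splitOffFrom-rightHand x x∈ } })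
    (HasCount-Tagged count (Unique.upTo⁺ (n ∸ 1)))
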